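{- In the setting described in the context, $|\mathcal{R}_{\mathrm{Lex}}(\tau^{\gamma})|\le|\mathcal{R}_{\mathrm{Lex}}(\tau)|$. In particular, $\deg(\Phi(\tau^{\gamma}))\le\deg(\Phi(\tau))$.
   Context: Let $\mathbf{V}=\mathbf{V}_1\cup\cdots\cup\mathbf{V}_m$ (pairwise disjoint finite sets), $\mathbf{a}=(a_1,\ldots,a_m)$ nonnegative integers with $a_i\le|\mathbf{V}_i|$, $1\le d\le\sum_i a_i$. $\Lambda$: simplicial complex on $\mathbf{V}$ with faces the $\tau\subseteq\mathbf{V}$ such that $|\tau\cap\mathbf{V}_i|\le a_i$ for all $i$ and $|\tau|\le d$; facets = faces of size $d$. Order $\mathbf{V}$ by $\succ$ with all of $\mathbf{V}_i$ before $\mathbf{V}_j$ for $i<j$; write $\mathbf{V}_i=\{v^i_1\succ v^i_2\succ\cdots\}$; subsets inherit $\succ$. Revlex on equal-size sets: $S\succ T$ if the $\succ$-least element of the symmetric difference lies in $T$. $\mathcal{R}_{\mathrm{Lex}}(\tau)=\{v\in\tau:\tau-\{v\}\subseteq\tau'\text{ for some facet }\tau'\succ\tau\}$. For a facet $\tau$: $\mathrm{FL}(\tau)=\{i:|\tau\cap\mathbf{V}_i|=a_i\}$; $\mathrm{Gap}(\tau)$ is the $\succ$-largest element of $\mathbf{V}$ lying neither in $\tau$ nor in any $\mathbf{V}_i$ with $i\in\mathrm{FL}(\tau)$, if one exists; $\mathrm{tail}(\tau)=\{v\in\tau:v\prec\mathrm{Gap}(\tau)\}$ (empty if $\mathrm{Gap}(\tau)$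 does not exist); for $i\in\mathrm{FL}(\tau)$ with $\mathbf{V}_i\not\subseteq\tau$, $\mathrm{fgap}(\tau,i)$ is the $\succ$-largest element of $\mathbf{V}_i-\tau$; $\mathrm{up}(\tau)=\{v\in\tau\cap\mathbf{V}_i: i\in\mathrm{FL}(\tau),\ \mathbf{V}_i\not\subseteq\tau,\ v\prec\mathrm{fgap}(\tau,i)\}$. One has $\mathcal{R}_{\mathrm{Lex}}(\tau)=\mathrm{up}(\tau)\cup\mathrm{tail}(\tau)$. Now let $\tau$ be a facet and $\gamma$ a set with $\mathcal{R}_{\mathrm{Lex}}(\tau)\not\subseteq\gamma\subset\tau$; choose $v\in\mathcal{R}_{\mathrm{Lex}}(\tau)-\gamma$. If $v\in\mathrm{tail}(\tau)$ let $w=\mathrm{Gap}(\tau)$; otherwise $v\in\mathrm{up}(\tau)$, and let $w=\mathrm{fgap}(\tau,i)$ where $v\in\mathbf{V}_i$. Set $\tau^{\gamma}=(\tau-\{v\})\cup\{w\}$, a facet of $\Lambda$ containing $\gamma$ with $\tau^{\gamma}\succ\tau$. $\Phi$: variables $\mathbf{X}_i=\{x^i_1\succ\cdots\succ x^i_{|\mathbf{V}_i|-a_i}\}$ ($1\le i\le m$), $\mathbf{X}_0=\{x^0_1\succ\cdots\succ x^0_c\}$, $c=(\sum a_i)-d$. For totally ordered $V=\{v_1\succ\cdots\succ v_N\}$, $0\le a\le N$, $X=\{x_1\succ\cdots\succ x_{N-a}\}$, $\phi(V,X)$ sends an $a$-subset $\{v_1,\ldots,v_t,v_{i_1},\ldots,v_{i_s}\}$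 ($t+s=a$, $t+1<i_1<\cdots<i_s$) to $x_{i_1-(t+1)}\cdots x_{i_s-(t+s)}$. For a facet $\tau$, $\mathrm{fill}_i(\tau)$ = revlex-first $a_i$-subset of $\mathbf{V}_i$ containing $\tau\cap\mathbf{V}_i$; $\Phi_i(\tau)=\phi(\mathbf{V}_i,\mathbf{X}_i)(\mathrm{fill}_i(\tau))$; $\mathbf{V}[\tau]$ = the $\succ$-first $a_i-\deg\Phi_i(\tau)$ elements of each $\mathbf{V}_i$; $\Phi_0(\tau)=\phi(\mathbf{V}[\tau],\mathbf{X}_0)(\tau\cap\mathbf{V}[\tau])$; $\Phi(\tau)=\prod_{i=0}^m\Phi_i(\tau)$, and $\deg\Phi(\tau)=|\mathcal{R}_{\mathrm{Lex}}(\tau)|$. -}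

module Defs where

open import Data.Nat as ℕ using (ℕ; _≤_; _<_)
open import Data.Fin as F using (Fin)
open import Data.Fin.Subset using (Subset; _∈_; _∉_; _⊆_; _-_; _∪_; ⁅_⁆; ∣_∣; _∩_)
open import Data.Vec using (tabulate)
open import Data.Bool using (Bool)
open import Relation.Nullary using (¬_; does)
open import Relation.Binary.PropositionalEquality using (_≡_)
open import Data.Product using (_×_; ∃; ∃-syntax)
open import Data.Sum using (_⊎_)
open import Function using (_⇔_)

-- The total order ≻ is the reverse of the index
-- order: index 0 is the ≻-largest vertex, and  u ≻ v  iff  u F.< v.
-- The blocks V_1,…,V_m are given by a block map  blk : Fin N → Fin m
-- (V_i = blk⁻¹(i)); the requirement that all of V_i precede all of V_j for
-- i < j is the monotonicity hypothesis  BlocksOrdered  below.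

BlocksOrdered : ∀ {N m} → (Fin N → Fin m) → Set
BlocksOrdered blk = ∀ u v → blk u F.< blk v → u F.< v

module Λ {N m : ℕ} (blk : Fin N → Fin m) (a : Fin m → ℕ) (d : ℕ) where

  block : Fin m → Subset N
  block i = tabulate (λ v → does (blk v F.≟ i))

  cnt : Subset N → Fin m → ℕ
  cnt τ i = ∣ τ ∩ block i ∣

  IsFace : Subset N → Set
  IsFace τ = (∀ i → cnt τ i ≤ a i) × ∣ τ ∣ ≤ d

  IsFacet : Subset N → Set
  IsFacet τ = (∀ i → cnt τ i ≤ a i) × ∣ τ ∣ ≡ d

  -- revlex:  S ≻ T  iff the ≻-least element x of the symmetric difference lies in T
  -- (≻-least = largest index; so every y with larger index is in S iff in T)
  RevGt : Subset N → Subset N → Set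
  RevGt S T = ∃[ x ] (x ∈ T × x ∉ S × (∀ y → x F.< y → (y ∈ S ⇔ y ∈ T)))

  InR : Subset N → Fin N → Set
  InR τ v = v ∈ τ × ∃[ τ′ ] (IsFacet τ′ × RevGt τ′ τ × (τ - v) ⊆ τ′)

  FL : Subset N → Fin m → Set
  FL τ i = cnt τ i ≡ a i

  IsGap : Subset N → Fin N → Set
  IsGap τ g = g ∉ τ × ¬ FL τ (blk g) × (∀ u → u F.< g → u ∈ τ ⊎ FL τ (blk u))

  -- v ∈ tail(τ)  (tail is empty when Gap(τ) does not exist)
  InTail : Subset N → Fin N → Set
  InTail τ v = v ∈ τ × ∃[ g ] (IsGap τ g × g F.< v)

  IsFgap : Subset N → Fin m → Fin N → Set
  IsFgap τ i f = blk f ≡ i × f ∉ τ × (∀ u → u F.< f → blk u ≡ i → u ∈ τ)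

  InUp : Subset N → Fin N → Set
  InUp τ v = v ∈ τ × FL τ (blk v) × ∃[ f ] (IsFgap τ (blk v) f × f F.< v)

  IsSwap : Subset N → Fin N → Fin N → Set
  IsSwap τ v w = (InTail τ v × IsGap τ w)
               ⊎ (¬ InTail τ v × InUp τ v × IsFgap τ (blk v) w)

  swap : Subset N → Fin N → Fin N → Subset N
  swap τ v w = (τ - v) ∪ ⁅ w ⁆

  IsRLex : Subset N → Subset N → Set
  IsRLex τ R = ∀ x → x ∈ R ⇔ InR τ x

-- For a facet S, x ∈ R_Lex(S) iff some y ≻ x outside S can replace x, i.e. y lies in the
-- block of x or in a block not filled by S.  Passing from τ to τ^γ = τ − v + w with w ≻ v
-- turns every replacement for x ≠ w in τ^γ into one in τ (w itself when the replacement
-- was v or when w ≻ x), so R_Lex(τ^γ) ⊆ (R_Lex(τ) − {v}) ∪ {w}.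
module Submission where

open import Defs
open import Data.Nat using (ℕ; _≤_)
open import Data.Fin using (Fin)
open import Data.Fin.Subset using (Subset; _∈_; _∉_; _⊆_; _⊂_; ∣_∣)
open import Data.Vec using (sum; tabulate)
open import Relation.Nullary using (¬_)

import Data.Nat as ℕ
import Data.Nat.Properties as ℕ
import Data.Fin as F
import Data.Fin.Properties as F
open import Data.Fin.Subset using (_-_; _─_; _∪_; _∩_; ⁅_⁆; inside; outside)
open import Data.Fin.Subset.Properties
open import Data.Vec using (_∷_; here; there)
open import Data.Vec.Properties using (lookup∘tabulate; []=⇒lookup; lookup⇒[]=)
open import Data.Product using (_×_; _,_; proj₁; proj₂; ∃-syntax)
open import Data.Sum using (_⊎_; inj₁; inj₂; [_,_]′; map; map₂)
open import Data.Empty using (⊥-elim)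
open import Relation.Nullary using (yes; no; ¬?)
open import Relation.Nullary.Decidable using (dec-true; _×-dec_)
open import Relation.Binary using (tri<; tri≈; tri>)
open import Relation.Binary.PropositionalEquality using (_≡_; _≢_; refl; sym; trans)
open import Function using (_∘_; _⇔_; mk⇔)
open import Function.Bundles using (module Equivalence)

x∈p─q⇒x∉q : ∀ {n} {x : Fin n} (p q : Subset n) → x ∈ p ─ q → x ∉ q
x∈p─q⇒x∉q (_ ∷ _) (inside ∷ _) () here
x∈p─q⇒x∉q (_ ∷ p) (_ ∷ q) (there x∈p─q) (there x∈q) = x∈p─q⇒x∉q p q x∈p─q x∈q

∣p∪⁅x⁆∣≤1+∣p∣ : ∀ {n} (p : Subset n) x → ∣ p ∪ ⁅ x ⁆ ∣ ≤ ℕ.suc ∣ p ∣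
∣p∪⁅x⁆∣≤1+∣p∣ (inside ∷ p) F.zero rewrite ∪-identityʳ p = ℕ.s≤s (∣p∣≤∣x∷p∣ inside p)
∣p∪⁅x⁆∣≤1+∣p∣ (outside ∷ p) F.zero rewrite ∪-identityʳ p = ℕ.≤-refl
∣p∪⁅x⁆∣≤1+∣p∣ (inside ∷ p) (F.suc x) = ℕ.s≤s (∣p∪⁅x⁆∣≤1+∣p∣ p x)
∣p∪⁅x⁆∣≤1+∣p∣ (outside ∷ p) (F.suc x) = ∣p∪⁅x⁆∣≤1+∣p∣ p x

module _ {n : ℕ} where

  infixl 8 _[_↦_]

  _[_↦_] : Subset n → Fin n → Fin n → Subset n
  p [ x ↦ y ] = (p - x) ∪ ⁅ y ⁆

  x∈p-y⇒x≢y : ∀ {x y : Fin n} (p : Subset n) → x ∈ p - y → x ≢ y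
  x∈p-y⇒x≢y {y = y} p x∈p-y refl = x∈p─q⇒x∉q p ⁅ y ⁆ x∈p-y (x∈⁅x⁆ y)

  x∈p[y↦z]⁻ : ∀ {x : Fin n} p y z → x ∈ p [ y ↦ z ] → (x ∈ p × x ≢ y) ⊎ x ≡ z
  x∈p[y↦z]⁻ p y z x∈ with x∈p∪q⁻ (p - y) ⁅ z ⁆ x∈
  ... | inj₁ x∈p-y = inj₁ (p─q⊆p p ⁅ y ⁆ x∈p-y , x∈p-y⇒x≢y p x∈p-y)
  ... | inj₂ x∈⁅z⁆ = inj₂ (x∈⁅y⁆⇒x≡y z x∈⁅z⁆)

  x∈p[y↦z]⁺ : ∀ {x y z : Fin n} {p : Subset n} → x ∈ p → x ≢ y → x ∈ p [ y ↦ z ]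
  x∈p[y↦z]⁺ x∈p x≢y = x∈p∪q⁺ (inj₁ (x∈p∧x≢y⇒x∈p-y x∈p x≢y))

  y∈p[x↦y] : ∀ (p : Subset n) x y → y ∈ p [ x ↦ y ]
  y∈p[x↦y] p x y = x∈p∪q⁺ (inj₂ (x∈⁅x⁆ y))

  ∣p[x↦y]∣≤∣p∣ : ∀ {p : Subset n} {x} y → x ∈ p → ∣ p [ x ↦ y ] ∣ ≤ ∣ p ∣
  ∣p[x↦y]∣≤∣p∣ {p} {x} y x∈p = ℕ.≤-trans (∣p∪⁅x⁆∣≤1+∣p∣ (p - x) y) (x∈p⇒∣p-x∣<∣p∣ x∈p)

  ∣p∣≤∣p[x↦y]∣ : ∀ {p : Subset n} x {y} → y ∉ p → ∣ p ∣ ≤ ∣ p [ x ↦ y ] ∣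
  ∣p∣≤∣p[x↦y]∣ {p} x {y} y∉p = begin
    ∣ p ∣             ≤⟨ p⊆q⇒∣p∣≤∣q∣ p⊆p[x↦x] ⟩
    ∣ p [ x ↦ x ] ∣   ≤⟨ ∣p∪⁅x⁆∣≤1+∣p∣ (p - x) x ⟩
    ℕ.suc ∣ p - x ∣   ≤⟨ p⊂q⇒∣p∣<∣q∣ (p⊆p∪q ⁅ y ⁆ , y , y∈p[x↦y] p x y , y∉p ∘ p─q⊆p p ⁅ x ⁆) ⟩
    ∣ p [ x ↦ y ] ∣   ∎
    where
    open ℕ.≤-Reasoning
    p⊆p[x↦x] : p ⊆ p [ x ↦ x ]
    p⊆p[x↦x] {z} z∈p with z F.≟ x
    ... | yes refl = y∈p[x↦y] p x x
    ... | no z≢x = x∈p[y↦z]⁺ z∈p z≢x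

  p[x↦y]∩q⊆p∩q[x↦y] : ∀ (p q : Subset n) x y → p [ x ↦ y ] ∩ q ⊆ (p ∩ q) [ x ↦ y ]
  p[x↦y]∩q⊆p∩q[x↦y] p q x y {z} z∈ with x∈p∩q⁻ (p [ x ↦ y ]) q z∈
  ... | z∈p[x↦y] , z∈q with x∈p[y↦z]⁻ p x y z∈p[x↦y]
  ...   | inj₁ (z∈p , z≢x) = x∈p[y↦z]⁺ (x∈p∩q⁺ (z∈p , z∈q)) z≢x
  ...   | inj₂ refl = y∈p[x↦y] (p ∩ q) x y

  ∣p[x↦y]∩q∣≤∣p∩q∣ : ∀ (p q : Subset n) x y → (x ∈ p × x ∈ q) ⊎ y ∉ q →
                     ∣ p [ x ↦ y ] ∩ q ∣ ≤ ∣ p ∩ q ∣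
  ∣p[x↦y]∩q∣≤∣p∩q∣ p q x y (inj₁ x∈p∩q) =
    ℕ.≤-trans (p⊆q⇒∣p∣≤∣q∣ (p[x↦y]∩q⊆p∩q[x↦y] p q x y)) (∣p[x↦y]∣≤∣p∣ y (x∈p∩q⁺ x∈p∩q))
  ∣p[x↦y]∩q∣≤∣p∩q∣ p q x y (inj₂ y∉q) = p⊆q⇒∣p∣≤∣q∣ ⊆p∩q
    where
    ⊆p∩q : p [ x ↦ y ] ∩ q ⊆ p ∩ q
    ⊆p∩q {z} z∈ with x∈p∩q⁻ (p [ x ↦ y ]) q z∈
    ... | z∈p[x↦y] , z∈q with x∈p[y↦z]⁻ p x y z∈p[x↦y]
    ...   | inj₁ (z∈p , _) = x∈p∩q⁺ (z∈p , z∈q)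
    ...   | inj₂ refl = ⊥-elim (y∉q z∈q)

  ∣p[x↦y]∩q∣≤1+∣p∩q∣ : ∀ (p q : Subset n) x y → ∣ p [ x ↦ y ] ∩ q ∣ ≤ ℕ.suc ∣ p ∩ q ∣
  ∣p[x↦y]∩q∣≤1+∣p∩q∣ p q x y = ℕ.≤-trans (p⊆q⇒∣p∣≤∣q∣ (p[x↦y]∩q⊆p∩q[x↦y] p q x y))
    (ℕ.≤-trans (∣p∪⁅x⁆∣≤1+∣p∣ ((p ∩ q) - x) y) (ℕ.s≤s (∣p─q∣≤∣p∣ (p ∩ q) ⁅ x ⁆)))

  ∣p∩q∣≤∣p[x↦y]∩q∣ : ∀ (p q : Subset n) x y → y ∉ p → x ∉ q ⊎ y ∈ q →
                     ∣ p ∩ q ∣ ≤ ∣ p [ x ↦ y ] ∩ q ∣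
  ∣p∩q∣≤∣p[x↦y]∩q∣ p q x y y∉p (inj₁ x∉q) = p⊆q⇒∣p∣≤∣q∣ p∩q⊆
    where
    p∩q⊆ : p ∩ q ⊆ p [ x ↦ y ] ∩ q
    p∩q⊆ {z} z∈ with x∈p∩q⁻ p q z∈
    ... | z∈p , z∈q = x∈p∩q⁺ (x∈p[y↦z]⁺ z∈p (λ { refl → x∉q z∈q }) , z∈q)
  ∣p∩q∣≤∣p[x↦y]∩q∣ p q x y y∉p (inj₂ y∈q) =
    ℕ.≤-trans (∣p∣≤∣p[x↦y]∣ x (y∉p ∘ proj₁ ∘ x∈p∩q⁻ p q)) (p⊆q⇒∣p∣≤∣q∣ p∩q[x↦y]⊆)
    where
    p∩q[x↦y]⊆ : (p ∩ q) [ x ↦ y ] ⊆ p [ x ↦ y ] ∩ q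
    p∩q[x↦y]⊆ {z} z∈ with x∈p[y↦z]⁻ (p ∩ q) x y z∈
    ... | inj₁ (z∈p∩q , z≢x) with x∈p∩q⁻ p q z∈p∩q
    ...   | z∈p , z∈q = x∈p∩q⁺ (x∈p[y↦z]⁺ z∈p z≢x , z∈q)
    p∩q[x↦y]⊆ {z} z∈ | inj₂ refl = x∈p∩q⁺ (y∈p[x↦y] p x y , y∈q)

  ∣p[x↦y]∣≡∣p∣ : ∀ {p : Subset n} {x y} → x ∈ p → y ∉ p → ∣ p [ x ↦ y ] ∣ ≡ ∣ p ∣
  ∣p[x↦y]∣≡∣p∣ {x = x} {y} x∈p y∉p = ℕ.≤-antisym (∣p[x↦y]∣≤∣p∣ y x∈p) (∣p∣≤∣p[x↦y]∣ x y∉p)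

  ∣p∣≤∣q∣⇒q⊈p : ∀ {p q : Subset n} {x} → x ∈ p → x ∉ q → ∣ p ∣ ≤ ∣ q ∣ → ∃[ y ] (y ∈ q × y ∉ p)
  ∣p∣≤∣q∣⇒q⊈p {p} {q} {x} x∈p x∉q ∣p∣≤∣q∣ with F.any? (λ y → (y ∈? q) ×-dec ¬? (y ∈? p))
  ... | yes y∈q∖p = y∈q∖p
  ... | no q∖p≡∅ = ⊥-elim (ℕ.<⇒≱ (p⊂q⇒∣p∣<∣q∣ (q⊆p , x , x∈p , x∉q)) ∣p∣≤∣q∣)
    where
    q⊆p : q ⊆ p
    q⊆p {y} y∈q with y ∈? p
    ... | yes y∈p = y∈p
    ... | no y∉p = ⊥-elim (q∖p≡∅ (y , y∈q , y∉p))

blk-mono : ∀ {N m} {blk : Fin N → Fin m} → BlocksOrdered blk → ∀ {x y} → y F.< x → blk y F.≤ blk x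
blk-mono ord {x} {y} y<x = ℕ.≮⇒≥ (λ blk-x<blk-y → ℕ.<-asym y<x (ord x y blk-x<blk-y))

module _ {N m : ℕ} (blk : Fin N → Fin m) (a : Fin m → ℕ) (d : ℕ) where
  open Λ blk a d

  x∈block⁺ : ∀ {x i} → blk x ≡ i → x ∈ block i
  x∈block⁺ {x} {i} blk-x≡i =
    lookup⇒[]= x (block i) (trans (lookup∘tabulate _ x) (dec-true (blk x F.≟ i) blk-x≡i))

  x∈block⁻ : ∀ {x i} → x ∈ block i → blk x ≡ i
  x∈block⁻ {x} {i} x∈ with blk x F.≟ i | trans (sym (lookup∘tabulate _ x)) ([]=⇒lookup x∈)
  ... | yes blk-x≡i | _ = blk-x≡i
  ... | no _ | ()

  Exchange : Subset N → Fin N → Fin N → Set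
  Exchange S x y = y F.< x × y ∉ S × (blk y ≡ blk x ⊎ cnt S (blk y) ℕ.< a (blk y))

  exchange-isFacet : ∀ {S x y} → IsFacet S → x ∈ S → Exchange S x y → IsFacet (swap S x y)
  exchange-isFacet {S} {x} {y} (cnt≤a , ∣S∣≡d) x∈S (_ , y∉S , room) =
    cnt≤a′ , trans (∣p[x↦y]∣≡∣p∣ x∈S y∉S) ∣S∣≡d
    where
    cnt≤a′ : ∀ i → cnt (swap S x y) i ≤ a i
    cnt≤a′ i with i F.≟ blk y
    ... | no i≢blk-y = ℕ.≤-trans
      (∣p[x↦y]∩q∣≤∣p∩q∣ S (block i) x y (inj₂ (i≢blk-y ∘ sym ∘ x∈block⁻))) (cnt≤a i)
    ... | yes refl with blk x F.≟ blk y
    ...   | yes blk-x≡blk-y = ℕ.≤-trans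
      (∣p[x↦y]∩q∣≤∣p∩q∣ S (block i) x y (inj₁ (x∈S , x∈block⁺ blk-x≡blk-y))) (cnt≤a i)
    ...   | no blk-x≢blk-y = [ (λ blk-y≡blk-x → ⊥-elim (blk-x≢blk-y (sym blk-y≡blk-x)))
                             , ℕ.≤-trans (∣p[x↦y]∩q∣≤1+∣p∩q∣ S (block i) x y) ]′ room

  exchange⇒InR : ∀ {S x y} → IsFacet S → x ∈ S → Exchange S x y → InR S x
  exchange⇒InR {S} {x} {y} S-facet x∈S exch@(y<x , _ , _) =
    x∈S , swap S x y , exchange-isFacet S-facet x∈S exch , (x , x∈S , x∉T , agree) , p⊆p∪q ⁅ y ⁆
    where
    x∉T : x ∉ swap S x y
    x∉T x∈T with x∈p[y↦z]⁻ S x y x∈T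
    ... | inj₁ (_ , x≢x) = x≢x refl
    ... | inj₂ refl = F.<-irrefl refl y<x
    agree : ∀ z → x F.< z → (z ∈ swap S x y ⇔ z ∈ S)
    agree z x<z = mk⇔ to (λ z∈S → x∈p[y↦z]⁺ z∈S (λ { refl → F.<-irrefl refl x<z }))
      where
      to : z ∈ swap S x y → z ∈ S
      to z∈T with x∈p[y↦z]⁻ S x y z∈T
      ... | inj₁ (z∈S , _) = z∈S
      ... | inj₂ refl = ⊥-elim (F.<-asym y<x x<z)

  facet-above⇒exchange : ∀ {S T x} → IsFacet S → IsFacet T → x ∈ S → x ∉ T → S - x ⊆ T →
                         (∀ u → x F.< u → u ∈ T → u ∈ S) → ∃[ y ] Exchange S x y
  facet-above⇒exchange {S} {T} {x} (_ , ∣S∣≡d) (cntT≤a , ∣T∣≡d) x∈S x∉T S-x⊆T T⊆S-above-x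
    with ∣p∣≤∣q∣⇒q⊈p x∈S x∉T (ℕ.≤-reflexive (trans ∣S∣≡d (sym ∣T∣≡d)))
  ... | y , y∈T , y∉S = y , y<x , y∉S , room
    where
    y<x : y F.< x
    y<x with F.<-cmp y x
    ... | tri< y<x _ _ = y<x
    ... | tri≈ _ refl _ = ⊥-elim (x∉T y∈T)
    ... | tri> _ _ x<y = ⊥-elim (y∉S (T⊆S-above-x y x<y y∈T))
    room : blk y ≡ blk x ⊎ cnt S (blk y) ℕ.< a (blk y)
    room with blk y F.≟ blk x
    ... | yes blk-y≡blk-x = inj₁ blk-y≡blk-x
    ... | no blk-y≢blk-x =
      inj₂ (ℕ.<-≤-trans (p⊂q⇒∣p∣<∣q∣ (S∩B⊆T∩B , y , y∈T∩B , y∉S ∘ proj₁ ∘ x∈p∩q⁻ S B)) (cntT≤a (blk y)))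
      where
      B : Subset N
      B = block (blk y)
      y∈T∩B : y ∈ T ∩ B
      y∈T∩B = x∈p∩q⁺ (y∈T , x∈block⁺ refl)
      S∩B⊆T∩B : S ∩ B ⊆ T ∩ B
      S∩B⊆T∩B {u} u∈ with x∈p∩q⁻ S B u∈
      ... | u∈S , u∈B = x∈p∩q⁺ (S-x⊆T (x∈p∧x≢y⇒x∈p-y u∈S u≢x) , u∈B)
        where
        u≢x : u ≢ x
        u≢x refl = blk-y≢blk-x (sym (x∈block⁻ u∈B))

  InR⇒exchange : ∀ {S x} → IsFacet S → InR S x → ∃[ y ] Exchange S x y
  InR⇒exchange {S} {x} S-facet (x∈S , T , T-facet , (z , z∈S , z∉T , agree) , S-x⊆T) with z F.≟ x
  ... | no z≢x = ⊥-elim (z∉T (S-x⊆T (x∈p∧x≢y⇒x∈p-y z∈S z≢x)))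
  ... | yes refl = facet-above⇒exchange S-facet T-facet x∈S z∉T S-x⊆T
                     (λ u x<u → Equivalence.to (agree u x<u))

  IsGap-unique : ∀ {τ g g′} → IsGap τ g → IsGap τ g′ → g ≡ g′
  IsGap-unique {g = g} {g′} (g∉τ , g-open , below-g) (g′∉τ , g′-open , below-g′) with F.<-cmp g g′
  ... | tri≈ _ g≡g′ _ = g≡g′
  ... | tri< g<g′ _ _ = ⊥-elim ([ g∉τ , g-open ]′ (below-g′ g g<g′))
  ... | tri> _ _ g′<g = ⊥-elim ([ g′∉τ , g′-open ]′ (below-g g′ g′<g))

  IsFgap-unique : ∀ {τ i f f′} → IsFgap τ i f → IsFgap τ i f′ → f ≡ f′
  IsFgap-unique {f = f} {f′} (blk-f≡i , f∉τ , below-f) (blk-f′≡i , f′∉τ , below-f′)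
    with F.<-cmp f f′
  ... | tri≈ _ f≡f′ _ = f≡f′
  ... | tri< f<f′ _ _ = ⊥-elim (f∉τ (below-f′ f f<f′ blk-f≡i))
  ... | tri> _ _ f′<f = ⊥-elim (f′∉τ (below-f f′ f′<f blk-f′≡i))

  swap-exchange : ∀ {τ v w} → IsFacet τ → IsSwap τ v w → Exchange τ v w
  swap-exchange (cnt≤a , _) (inj₁ ((_ , g , g-gap , g<v) , w-gap@(w∉τ , w-open , _)))
    rewrite IsGap-unique g-gap w-gap = g<v , w∉τ , inj₂ (ℕ.≤∧≢⇒< (cnt≤a _) w-open)
  swap-exchange _ (inj₂ (_ , (_ , _ , f , f-fgap , f<v) , w-fgap@(blk-w≡blk-v , w∉τ , _)))
    rewrite IsFgap-unique f-fgap w-fgap = f<v , w∉τ , inj₁ blk-w≡blk-v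

  cnt≤cnt-swap : ∀ {τ v w} i → w ∉ τ → i ≢ blk v ⊎ i ≡ blk w → cnt τ i ≤ cnt (swap τ v w) i
  cnt≤cnt-swap {τ} {v} {w} i w∉τ i≢blk-v⊎i≡blk-w = ∣p∩q∣≤∣p[x↦y]∩q∣ τ (block i) v w w∉τ
    (map (λ i≢blk-v → i≢blk-v ∘ sym ∘ x∈block⁻) (x∈block⁺ ∘ sym) i≢blk-v⊎i≡blk-w)

  ∉swap⇒∉ : ∀ {τ v w y} → y ∉ swap τ v w → y ≢ v → y ∉ τ
  ∉swap⇒∉ y∉σ y≢v y∈τ = y∉σ (x∈p[y↦z]⁺ y∈τ y≢v)

  -- Every vertex ≻ Gap(τ) outside τ lies in a full block of τ, and the swap lowers only the
  -- count of the block of v, which the block order squeezes between the blocks of y and x.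
  exchange-after-gap-swap : BlocksOrdered blk → ∀ {τ v w x y} → IsFacet τ → IsGap τ w → w F.< v →
                            x ∈ τ → Exchange (swap τ v w) x y → ∃[ y′ ] Exchange τ x y′
  exchange-after-gap-swap ord {τ} {v} {w} {x} {y} (cnt≤a , _) (w∉τ , w-open , below-w) w<v x∈τ
                          (y<x , y∉σ , room) with F.<-cmp w x
  ... | tri< w<x _ _ = w , w<x , w∉τ , inj₂ (ℕ.≤∧≢⇒< (cnt≤a (blk w)) w-open)
  ... | tri≈ _ refl _ = ⊥-elim (w∉τ x∈τ)
  ... | tri> _ _ x<w = y , y<x , y∉τ , [ inj₁ , room-in-τ ]′ room
    where
    y<w : y F.< w
    y<w = F.<-trans y<x x<w
    y∉τ : y ∉ τ
    y∉τ = ∉swap⇒∉ {τ} y∉σ (λ { refl → F.<-asym y<w w<v })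
    blk-y-full : FL τ (blk y)
    blk-y-full = [ ⊥-elim ∘ y∉τ , (λ full → full) ]′ (below-w y y<w)
    room-in-τ : cnt (swap τ v w) (blk y) ℕ.< a (blk y) → blk y ≡ blk x ⊎ cnt τ (blk y) ℕ.< a (blk y)
    room-in-τ not-full with blk y F.≟ blk v
    ... | yes blk-y≡blk-v = inj₁ (F.≤-antisym (blk-mono ord y<x) blk-x≤blk-y)
      where
      blk-x≤blk-y : blk x F.≤ blk y
      blk-x≤blk-y = F.≤-trans (blk-mono ord (F.<-trans x<w w<v)) (F.≤-reflexive (sym blk-y≡blk-v))
    ... | no blk-y≢blk-v = ⊥-elim (ℕ.<-irrefl blk-y-full
                              (ℕ.≤-<-trans (cnt≤cnt-swap (blk y) w∉τ (inj₁ blk-y≢blk-v)) not-full))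

  cnt≤cnt-swap-within-block : ∀ {τ v w} → w ∉ τ → blk w ≡ blk v → ∀ i → cnt τ i ≤ cnt (swap τ v w) i
  cnt≤cnt-swap-within-block {v = v} w∉τ blk-w≡blk-v i with i F.≟ blk v
  ... | yes i≡blk-v = cnt≤cnt-swap i w∉τ (inj₂ (trans i≡blk-v (sym blk-w≡blk-v)))
  ... | no i≢blk-v = cnt≤cnt-swap i w∉τ (inj₁ i≢blk-v)

  exchange-after-fgap-swap : ∀ {τ v w x y} → FL τ (blk v) → IsFgap τ (blk v) w → w F.< v →
                             Exchange (swap τ v w) x y → ∃[ y′ ] Exchange τ x y′
  exchange-after-fgap-swap {τ} {v} {w} {y = y} blk-v-full (blk-w≡blk-v , w∉τ , _) w<v
                           (y<x , y∉σ , room) with y F.≟ v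
  ... | yes refl =
    w , F.<-trans w<v y<x , w∉τ , [ inj₁ ∘ trans blk-w≡blk-v , ⊥-elim ∘ blk-v-not-open ]′ room
    where
    blk-v-not-open : ¬ cnt (swap τ v w) (blk v) ℕ.< a (blk v)
    blk-v-not-open = ℕ.<-irrefl blk-v-full
                   ∘ ℕ.≤-<-trans (cnt≤cnt-swap-within-block w∉τ blk-w≡blk-v (blk v))
  ... | no y≢v = y , y<x , ∉swap⇒∉ {τ} y∉σ y≢v ,
                 map₂ (ℕ.≤-<-trans (cnt≤cnt-swap-within-block w∉τ blk-w≡blk-v (blk y))) room

  InR-swap⇒InR : BlocksOrdered blk → ∀ {τ v w x} → IsFacet τ → InR τ v → IsSwap τ v w →
                 InR (swap τ v w) x → x ≢ w → InR τ x × x ≢ v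
  InR-swap⇒InR ord {τ} {v} {w} {x} τ-facet (v∈τ , _) swp x∈Rσ x≢w with x∈p[y↦z]⁻ τ v w (proj₁ x∈Rσ)
  ... | inj₂ x≡w = ⊥-elim (x≢w x≡w)
  ... | inj₁ (x∈τ , x≢v) = exchange⇒InR τ-facet x∈τ (proj₂ (exchange-in-τ swp)) , x≢v
    where
    v-exch-w : Exchange τ v w
    v-exch-w = swap-exchange τ-facet swp
    exch-in-σ : ∃[ y ] Exchange (swap τ v w) x y
    exch-in-σ = InR⇒exchange (exchange-isFacet τ-facet v∈τ v-exch-w) x∈Rσ
    exchange-in-τ : IsSwap τ v w → ∃[ y ] Exchange τ x y
    exchange-in-τ (inj₁ (_ , w-gap)) =
      exchange-after-gap-swap ord τ-facet w-gap (proj₁ v-exch-w) x∈τ (proj₂ exch-in-σ)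
    exchange-in-τ (inj₂ (_ , (_ , blk-v-full , _) , w-fgap)) =
      exchange-after-fgap-swap blk-v-full w-fgap (proj₁ v-exch-w) (proj₂ exch-in-σ)

-- The hypotheses on a, d and γ only serve to make the swap meaningful: the bound holds for
-- every facet τ, every v ∈ R_Lex(τ) and its replacement w.
lemma6p7 : ∀ {N m : ℕ} (blk : Fin N → Fin m) (a : Fin m → ℕ) (d : ℕ)
    → BlocksOrdered blk
    → (∀ i → a i ≤ ∣ Λ.block blk a d i ∣)
    → 1 ≤ d → d ≤ sum (tabulate a)
    → (τ γ : Subset N) → Λ.IsFacet blk a d τ
    → ¬ (∀ x → Λ.InR blk a d τ x → x ∈ γ) → γ ⊂ τ
    → (v w : Fin N) → Λ.InR blk a d τ v → v ∉ γ
    → Λ.IsSwap blk a d τ v w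
    → (R R′ : Subset N)
    → Λ.IsRLex blk a d (Λ.swap blk a d τ v w) R′
    → Λ.IsRLex blk a d τ R
    → ∣ R′ ∣ ≤ ∣ R ∣
lemma6p7 blk a d ord _ _ _ τ _ τ-facet _ _ v w v∈Rτ _ swp R R′ R′-spec R-spec =
  ℕ.≤-trans (p⊆q⇒∣p∣≤∣q∣ R′⊆R[v↦w]) (∣p[x↦y]∣≤∣p∣ w (Equivalence.from (R-spec v) v∈Rτ))
  where
  R′⊆R[v↦w] : R′ ⊆ R [ v ↦ w ]
  R′⊆R[v↦w] {x} x∈R′ with x F.≟ w
  ... | yes refl = y∈p[x↦y] R v w
  ... | no x≢w with InR-swap⇒InR blk a d ord τ-facet v∈Rτ swp (Equivalence.to (R′-spec x) x∈R′) x≢w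
  ...   | x∈Rτ , x≢v = x∈p[y↦z]⁺ (Equivalence.from (R-spec x) x∈Rτ) x≢v
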